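{- Let $r\geq k\geq 1$. For all positive integers $n,m$, we have $\mathrm{tc}_{r,k}(K_{n,m})\leq r-k+1$ if $k\geq r/2$, and $\mathrm{tc}_{r,k}(K_{n,m})\leq 2r-3k+2$ otherwise.
   Context: For integers $r\geq k\geq 1$, an $(r,k)$-colouring of a graph $G$ is a function $\varphi:E(G)\to\binom{[r]}{k}$, assigning to each edge a set of exactly $k$ colours from $[r]=\{1,\dots,r\}$. A subgraph $H\subseteq G$ is monochromatic if there is a colour $i$ belonging to $\varphi(e)$ for every $e\in E(H)$. $\mathrm{tc}(G,\varphi)$ is the minimum number of monochromatic trees (a single vertex counts as a tree) whose union covers $V(G)$, and $\mathrm{tc}_{r,k}(G)$ is the minimum $m$ such that every $(r,k)$-colouring $\varphi$ of $G$ satisfies $\mathrm{tc}(G,\varphi)\leq m$. $K_{n,m}$ is the complete bipartite graph with parts of sizes $n$ and $m$. -}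

module Defs where

open import Data.Nat using (ℕ; _≤_; _*_; _+_; _∸_; suc)
open import Data.Nat.Properties using (_≤?_)
open import Data.Fin using (Fin)
open import Data.Fin.Subset using (Subset; _∈_; ∣_∣)
open import Data.Sum using (_⊎_; inj₁; inj₂)
open import Data.Product using (Σ; Σ-syntax; ∃; ∃-syntax; _×_; proj₁)
open import Data.List using (List; [_]; _∷_)
open import Data.List.Membership.Propositional renaming (_∈_ to _∈ₗ_; _∉_ to _∉ₗ_)
open import Data.Empty using (⊥)
open import Relation.Binary.PropositionalEquality using (_≡_)
open import Relation.Nullary using (yes; no)

KSubset : ℕ → ℕ → Set
KSubset r k = Σ[ s ∈ Subset r ] ∣ s ∣ ≡ k

Vtx : ℕ → ℕ → Set
Vtx n m = Fin n ⊎ Fin m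

-- An (r,k)-colouring of K_{n,m}: each edge ij (i in part 1, j in part 2)
-- receives a set of exactly k colours.
Colouring : ℕ → ℕ → ℕ → ℕ → Set
Colouring r k n m = Fin n → Fin m → KSubset r k

EdgeCol : ∀ {r k n m} → Colouring r k n m → Fin r → Vtx n m → Vtx n m → Set
EdgeCol φ c (inj₁ i) (inj₂ j) = c ∈ proj₁ (φ i j)
EdgeCol φ c (inj₂ j) (inj₁ i) = c ∈ proj₁ (φ i j)
EdgeCol φ c (inj₁ _) (inj₁ _) = ⊥
EdgeCol φ c (inj₂ _) (inj₂ _) = ⊥

data IsMonoTree {r k n m} (φ : Colouring r k n m) (c : Fin r) :
       List (Vtx n m) → Set where
  single : (v : Vtx n m) → IsMonoTree φ c [ v ]
  leaf   : ∀ {vs} (u v : Vtx n m) → IsMonoTree φ c vs →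
           u ∉ₗ vs → v ∈ₗ vs → EdgeCol φ c u v →
           IsMonoTree φ c (u ∷ vs)

record MonoTree {r k n m} (φ : Colouring r k n m) : Set where
  constructor monoTree
  field
    colour   : Fin r
    vertices : List (Vtx n m)
    isTree   : IsMonoTree φ colour vertices
open MonoTree public

TcAtMost : ∀ {r k n m} → Colouring r k n m → ℕ → Set
TcAtMost {n = n} {m = m} φ b =
  Σ[ t ∈ ℕ ] t ≤ b × Σ[ T ∈ (Fin t → MonoTree φ) ]
    ((v : Vtx n m) → ∃[ i ] v ∈ₗ vertices (T i))

TcRK-AtMost : ℕ → ℕ → ℕ → ℕ → ℕ → Set
TcRK-AtMost r k n m b = (φ : Colouring r k n m) → TcAtMost φ b

-- The bound: r - k + 1 if k ≥ r/2 (i.e. 2k ≥ r), and 2r - 3k + 2 otherwise.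
bound : ℕ → ℕ → ℕ
bound r k with r ≤? 2 * k
... | yes _ = r ∸ k + 1
... | no  _ = 2 * r ∸ 3 * k + 2

-- Fix the edge xy, x = inj₁ 0 and y = inj₂ 0, and let S be its k colours. For a colour c, the
-- c-coloured ball of radius 2 around x contains every b with c ∈ φ(x,b) and every a with
-- c ∈ S ∩ φ(a,y), while the ball of radius 1 around y contains every a with c ∈ φ(a,y). A set P
-- of more than r − k colours meets every colour set, so if all colours of P outside S lie in Q,
-- the x-balls of P and the y-balls of Q cover every vertex. For r < 2k take P ⊆ S with
-- |P| = r − k + 1 and Q = ∅; for r > 2k take P = S ∪ Q with Q ⊆ ∁S of size r − 2k + 1, giving
-- 2r − 3k + 2 trees. For r = 2k the k x-balls of S miss only the "bad" vertices, whose edge to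
-- x or y has colour set exactly ∁S. One more tree covers all of them: a colour of ∁S on an edge
-- between two bad vertices joins them all through x and y; otherwise every such edge carries
-- exactly S, and a ball around one bad vertex suffices.

module Submission where

open import Defs
open import Data.Nat using (ℕ; zero; suc; _+_; _*_; _∸_; _≤_; _<_; z≤n; s≤s)
open import Data.Nat.Properties
open import Data.Bool using (true; false)
open import Data.Vec using ([]; _∷_; here; there)
open import Data.Fin using (Fin; zero; suc)
import Data.Fin.Properties as Fin
open import Data.Fin.Subset using (Subset; _∈_; _∉_; _⊆_; ∣_∣; _∩_; _∪_; ∁; ⊤; ⊥; Nonempty; Empty)
open import Data.Fin.Subset.Properties
open import Data.Sum using (inj₁; inj₂)
open import Data.Sum.Properties using (≡-dec)
open import Data.Product using (Σ-syntax; ∃; ∃-syntax; _×_; _,_; proj₁; proj₂)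
open import Data.List using (List; []; _∷_; [_]; _++_; map; length; lookup; allFin)
open import Data.List.Properties using (length-++; length-map)
open import Data.List.Membership.Propositional using (find; lose) renaming (_∈_ to _∈ₗ_)
open import Data.List.Membership.Propositional.Properties using (∈-map⁺; ∈-++⁺ˡ; ∈-++⁺ʳ; ∈-allFin)
open import Data.List.Relation.Binary.Subset.Propositional renaming (_⊆_ to _⊆ₗ_)
open import Data.List.Relation.Unary.Any as Any using (Any)
open import Data.List.Relation.Unary.Any.Properties using (map⁺; ++⁺ˡ; ++⁺ʳ; lookup-index)
open import Relation.Nullary using (Dec; yes; no; ¬_; contradiction)
open import Relation.Nullary.Decidable using (¬?; _×-dec_)
open import Data.Nat.Tactic.RingSolver using (solve-∀)
open import Relation.Binary.PropositionalEquality using (_≡_; refl; sym; trans; cong; cong₂; subst; module ≡-Reasoning)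

private
  variable
    r k n m : ℕ

toList : Subset n → List (Fin n)
toList []          = []
toList (true ∷ p)  = zero ∷ map suc (toList p)
toList (false ∷ p) = map suc (toList p)

length-toList : (p : Subset n) → length (toList p) ≡ ∣ p ∣
length-toList []          = refl
length-toList (true ∷ p)  = cong suc (trans (length-map suc (toList p)) (length-toList p))
length-toList (false ∷ p) = trans (length-map suc (toList p)) (length-toList p)

∈-toList : {p : Subset n} {x : Fin n} → x ∈ p → x ∈ₗ toList p
∈-toList {p = true ∷ p}  here      = Any.here refl
∈-toList {p = true ∷ p}  (there x) = Any.there (∈-map⁺ suc (∈-toList x))
∈-toList {p = false ∷ p} (there x) = ∈-map⁺ suc (∈-toList x)

∣p∪q∣≡∣p∣+∣q∣ : (p q : Subset n) → Empty (p ∩ q) → ∣ p ∪ q ∣ ≡ ∣ p ∣ + ∣ q ∣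
∣p∪q∣≡∣p∣+∣q∣ []          []          _ = refl
∣p∪q∣≡∣p∣+∣q∣ (true ∷ p)  (true ∷ q)  e = contradiction (zero , here) e
∣p∪q∣≡∣p∣+∣q∣ (true ∷ p)  (false ∷ q) e = cong suc (∣p∪q∣≡∣p∣+∣q∣ p q (drop-∷-Empty e))
∣p∪q∣≡∣p∣+∣q∣ (false ∷ p) (true ∷ q)  e =
  trans (cong suc (∣p∪q∣≡∣p∣+∣q∣ p q (drop-∷-Empty e))) (sym (+-suc ∣ p ∣ ∣ q ∣))
∣p∪q∣≡∣p∣+∣q∣ (false ∷ p) (false ∷ q) e = ∣p∪q∣≡∣p∣+∣q∣ p q (drop-∷-Empty e)

n<∣p∣+∣q∣⇒p∩q≢∅ : (p q : Subset n) → n < ∣ p ∣ + ∣ q ∣ → Nonempty (p ∩ q)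
n<∣p∣+∣q∣⇒p∩q≢∅ p q n< with nonempty? (p ∩ q)
... | yes ne = ne
... | no  e  = contradiction (∣p∣≤n (p ∪ q)) (<⇒≱ (subst (_ <_) (sym (∣p∪q∣≡∣p∣+∣q∣ p q e)) n<))

p∩q≡∅⇒∁p⊆q : (p q : Subset n) → Empty (p ∩ q) → n ≤ ∣ p ∣ + ∣ q ∣ → ∁ p ⊆ q
p∩q≡∅⇒∁p⊆q {n} p q e n≤ {x} x∈∁p with x∈p∪q⁻ p q (subst (x ∈_) (sym p∪q≡⊤) ∈⊤)
  where
  p∪q≡⊤ : p ∪ q ≡ ⊤
  p∪q≡⊤ = ∣p∣≡n⇒p≡⊤ (≤-antisym (∣p∣≤n (p ∪ q)) (subst (n ≤_) (sym (∣p∪q∣≡∣p∣+∣q∣ p q e)) n≤))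
... | inj₁ x∈p = contradiction x∈p (x∈∁p⇒x∉p x∈∁p)
... | inj₂ x∈q = x∈q

0<∣p∣⇒p≢∅ : (p : Subset n) → 0 < ∣ p ∣ → Nonempty p
0<∣p∣⇒p≢∅ {n} p 0<∣p∣ with nonempty? p
... | yes ne = ne
... | no  e  = contradiction (trans (cong ∣_∣ (Empty-unique e)) (∣⊥∣≡0 n)) (>⇒≢ 0<∣p∣)

∃-⊆-of-size : (p : Subset n) (j : ℕ) → j ≤ ∣ p ∣ → ∃[ q ] q ⊆ p × ∣ q ∣ ≡ j
∃-⊆-of-size []          zero    _ = [] , (λ ()) , refl
∃-⊆-of-size (false ∷ p) j       j≤ =
  let (q , q⊆p , ∣q∣) = ∃-⊆-of-size p j j≤ in false ∷ q , out⊆ q⊆p , ∣q∣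
∃-⊆-of-size (true ∷ p)  zero    _ =
  let (q , q⊆p , ∣q∣) = ∃-⊆-of-size p zero z≤n in false ∷ q , out⊆ q⊆p , ∣q∣
∃-⊆-of-size (true ∷ p)  (suc j) (s≤s j≤) =
  let (q , q⊆p , ∣q∣) = ∃-⊆-of-size p j j≤ in true ∷ q , s⊆s q⊆p , cong suc ∣q∣

allVtx : List (Vtx n m)
allVtx {n} {m} = map inj₁ (allFin n) ++ map inj₂ (allFin m)

∈-allVtx : (v : Vtx n m) → v ∈ₗ allVtx
∈-allVtx (inj₁ i) = ∈-++⁺ˡ (∈-map⁺ inj₁ (∈-allFin i))
∈-allVtx (inj₂ j) = ∈-++⁺ʳ _ (∈-map⁺ inj₂ (∈-allFin j))

module MonoTrees (φ : Colouring r k n m) where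

  V : Set
  V = Vtx n m

  open import Data.List.Membership.DecPropositional (≡-dec (Fin._≟_ {n}) (Fin._≟_ {m})) using () renaming (_∈?_ to _∈ₗ?_)

  EdgeCol? : (c : Fin r) (u v : V) → Dec (EdgeCol φ c u v)
  EdgeCol? c (inj₁ i) (inj₂ j) = c ∈? proj₁ (φ i j)
  EdgeCol? c (inj₂ j) (inj₁ i) = c ∈? proj₁ (φ i j)
  EdgeCol? c (inj₁ _) (inj₁ _) = no λ ()
  EdgeCol? c (inj₂ _) (inj₂ _) = no λ ()

  EdgeCol-sym : {c : Fin r} (u v : V) → EdgeCol φ c u v → EdgeCol φ c v u
  EdgeCol-sym (inj₁ i) (inj₂ j) e = e
  EdgeCol-sym (inj₂ j) (inj₁ i) e = e

  Absorbs : Fin r → List V → List V → List V → Set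
  Absorbs c us vs ws = ∀ {u v} → u ∈ₗ us → v ∈ₗ vs → EdgeCol φ c u v → u ∈ₗ ws

  extend : {c : Fin r} {vs : List V} → IsMonoTree φ c vs → (us : List V) →
           ∃[ ws ] IsMonoTree φ c ws × vs ⊆ₗ ws × Absorbs c us vs ws
  extend {vs = vs} T [] = vs , T , (λ v∈ → v∈) , λ ()
  extend {c} {vs} T (u ∷ us) with extend T us
  ... | ws , T′ , vs⊆ws , absorbs with u ∈ₗ? ws
  ...   | yes u∈ws = ws , T′ , vs⊆ws , λ { (Any.here refl) _ _ → u∈ws ; (Any.there u∈) → absorbs u∈ }
  ...   | no  u∉ws with Any.any? (EdgeCol? c u) vs
  ...     | yes adj =
              let (v , v∈vs , e) = find adj in
              u ∷ ws , leaf u v T′ u∉ws (vs⊆ws v∈vs) e , (λ v∈ → Any.there (vs⊆ws v∈)) ,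
              λ { (Any.here refl) _ _ → Any.here refl ; (Any.there u∈) v∈ e′ → Any.there (absorbs u∈ v∈ e′) }
  ...     | no ¬adj =
              ws , T′ , vs⊆ws ,
              λ { (Any.here refl) v∈ e → contradiction (lose v∈ e) ¬adj ; (Any.there u∈) → absorbs u∈ }

  ball-tree : (c : Fin r) → V → ℕ → ∃ (IsMonoTree φ c)
  ball-tree c x zero    = [ x ] , single x
  ball-tree c x (suc d) = let (ws , T , _) = extend (proj₂ (ball-tree c x d)) allVtx in ws , T

  ball : Fin r → V → ℕ → MonoTree φ
  ball c x d = monoTree c (proj₁ (ball-tree c x d)) (proj₂ (ball-tree c x d))

  ball-⊆-suc : {c : Fin r} {x : V} (d : ℕ) → vertices (ball c x d) ⊆ₗ vertices (ball c x (suc d))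
  ball-⊆-suc {c} {x} d = proj₁ (proj₂ (proj₂ (extend (proj₂ (ball-tree c x d)) allVtx)))

  ball-step : {c : Fin r} {x u v : V} (d : ℕ) → v ∈ₗ vertices (ball c x d) →
              EdgeCol φ c v u → u ∈ₗ vertices (ball c x (suc d))
  ball-step {c} {x} {u} {v} d v∈ e =
    proj₂ (proj₂ (proj₂ (extend (proj₂ (ball-tree c x d)) allVtx))) (∈-allVtx u) v∈ (EdgeCol-sym v u e)

  centre∈ball : {c : Fin r} {x : V} (d : ℕ) → x ∈ₗ vertices (ball c x d)
  centre∈ball zero    = Any.here refl
  centre∈ball (suc d) = ball-⊆-suc d (centre∈ball d)

  data Walk≤ (c : Fin r) (x : V) : ℕ → V → Set where
    stay : {d : ℕ} → Walk≤ c x d x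
    step : {d : ℕ} {v : V} → Walk≤ c x d v → (u : V) → EdgeCol φ c v u → Walk≤ c x (suc d) u

  infixl 5 step
  syntax step w u e = w ▷⟨ e ⟩ u

  walk⇒∈ball : {c : Fin r} {v : V} (x : V) (d : ℕ) → Walk≤ c x d v → v ∈ₗ vertices (ball c x d)
  walk⇒∈ball x d       stay    = centre∈ball d
  walk⇒∈ball x (suc d) (w ▷⟨ e ⟩ _) = ball-step d (walk⇒∈ball x d w) e

  Covers : List (MonoTree φ) → Set
  Covers Ts = (v : V) → Any (λ T → v ∈ₗ vertices T) Ts

  covers⇒TcAtMost : {b : ℕ} (Ts : List (MonoTree φ)) → length Ts ≤ b → Covers Ts → TcAtMost φ b
  covers⇒TcAtMost Ts len cov = length Ts , len , lookup Ts , λ v → Any.index (cov v) , lookup-index (cov v)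

  ∈-trees-over : {f : Fin r → MonoTree φ} {P : Subset r} {c : Fin r} {v : V} →
                 c ∈ P → v ∈ₗ vertices (f c) → Any (λ T → v ∈ₗ vertices T) (map f (toList P))
  ∈-trees-over c∈P v∈ = map⁺ (lose (∈-toList c∈P) v∈)

2*k∸k≡k : (k : ℕ) → 2 * k ∸ k ≡ k
2*k∸k≡k k = trans (m+n∸m≡n k (k + 0)) (+-identityʳ k)

r<k+[r∸k+1] : k ≤ r → r < k + (r ∸ k + 1)
r<k+[r∸k+1] {k} {r} k≤r = ≤-reflexive (sym (begin
  k + (r ∸ k + 1)  ≡⟨ +-assoc k (r ∸ k) 1 ⟨
  k + (r ∸ k) + 1  ≡⟨ cong (_+ 1) (m+[n∸m]≡n k≤r) ⟩
  r + 1            ≡⟨ +-comm r 1 ⟩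
  suc r            ∎))
  where open ≡-Reasoning

r<2k⇒r∸k+1≤k : k ≤ r → r < 2 * k → r ∸ k + 1 ≤ k
r<2k⇒r∸k+1≤k {k} {r} k≤r r<2k = begin
  r ∸ k + 1    ≡⟨ +-comm (r ∸ k) 1 ⟩
  suc (r ∸ k)  ≤⟨ ∸-monoˡ-< r<2k k≤r ⟩
  2 * k ∸ k    ≡⟨ 2*k∸k≡k k ⟩
  k            ∎
  where open ≤-Reasoning

2k<r⇒sizes : 1 ≤ k → 2 * k < r →
             ∃[ j ] j ≤ r ∸ k × r < k + (k + j) × k + j + j ≡ 2 * r ∸ 3 * k + 2
2k<r⇒sizes {k} 1≤k 2k<r with m≤n⇒∃[o]m+o≡n 2k<r
-- r = 2k + 1 + e, and j = r − 2k + 1 = 2 + e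
... | e , refl = 2 + e , 2+e≤r∸k , ≤-reflexive (r+1≡k+[k+2+e] k e) , count
  where
  open ≡-Reasoning
  r≡k+[k+1+e] : ∀ k e → suc (2 * k) + e ≡ k + (k + suc e)
  r≡k+[k+1+e] = solve-∀
  r+1≡k+[k+2+e] : ∀ k e → suc (suc (2 * k) + e) ≡ k + (k + (2 + e))
  r+1≡k+[k+2+e] = solve-∀
  2r≡3k+[k+2+2e] : ∀ k e → 2 * (suc (2 * k) + e) ≡ 3 * k + (k + 2 * (1 + e))
  2r≡3k+[k+2+2e] = solve-∀
  k+2[2+e]≡ : ∀ k e → k + (2 + e) + (2 + e) ≡ k + 2 * (1 + e) + 2
  k+2[2+e]≡ = solve-∀
  2+e≤r∸k : 2 + e ≤ suc (2 * k) + e ∸ k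
  2+e≤r∸k = subst (2 + e ≤_) (sym (trans (cong (_∸ k) (r≡k+[k+1+e] k e)) (m+n∸m≡n k _))) (+-monoˡ-≤ (suc e) 1≤k)
  count : k + (2 + e) + (2 + e) ≡ 2 * (suc (2 * k) + e) ∸ 3 * k + 2
  count = begin
    k + (2 + e) + (2 + e)                  ≡⟨ k+2[2+e]≡ k e ⟩
    k + 2 * (1 + e) + 2                    ≡⟨ cong (_+ 2) (m+n∸m≡n (3 * k) _) ⟨
    3 * k + (k + 2 * (1 + e)) ∸ 3 * k + 2  ≡⟨ cong (λ t → t ∸ 3 * k + 2) (2r≡3k+[k+2+2e] k e) ⟨
    2 * (suc (2 * k) + e) ∸ 3 * k + 2      ∎

module Covering (φ : Colouring r k (suc n) (suc m)) where

  open MonoTrees φ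

  col : Fin (suc n) → Fin (suc m) → Subset r
  col i j = proj₁ (φ i j)

  ∣col∣ : (i : Fin (suc n)) (j : Fin (suc m)) → ∣ col i j ∣ ≡ k
  ∣col∣ i j = proj₂ (φ i j)

  x y : V
  x = inj₁ zero
  y = inj₂ zero

  S : Subset r
  S = col zero zero

  ∣∁S∣ : ∣ ∁ S ∣ ≡ r ∸ k
  ∣∁S∣ = trans (∣∁p∣≡n∸∣p∣ S) (cong (r ∸_) (∣col∣ zero zero))

  x-ball y-ball : Fin r → MonoTree φ
  x-ball c = ball c x 2
  y-ball c = ball c y 1

  inj₂∈x-ball : {c : Fin r} {b : Fin (suc m)} → c ∈ col zero b → inj₂ b ∈ₗ vertices (x-ball c)
  inj₂∈x-ball {b = b} c∈xb = walk⇒∈ball x 2 (stay ▷⟨ c∈xb ⟩ inj₂ b)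

  inj₁∈x-ball : {c : Fin r} {a : Fin (suc n)} → c ∈ S → c ∈ col a zero → inj₁ a ∈ₗ vertices (x-ball c)
  inj₁∈x-ball {a = a} c∈S c∈ay = walk⇒∈ball x 2 (stay ▷⟨ c∈S ⟩ y ▷⟨ c∈ay ⟩ inj₁ a)

  inj₁∈y-ball : {c : Fin r} {a : Fin (suc n)} → c ∈ col a zero → inj₁ a ∈ₗ vertices (y-ball c)
  inj₁∈y-ball {a = a} c∈ay = walk⇒∈ball y 1 (stay ▷⟨ c∈ay ⟩ inj₁ a)

  length-trees-over : (f : Fin r → MonoTree φ) (P : Subset r) → length (map f (toList P)) ≡ ∣ P ∣
  length-trees-over f P = trans (length-map f (toList P)) (length-toList P)

  col-meets : (i : Fin (suc n)) (j : Fin (suc m)) (P : Subset r) → r < k + ∣ P ∣ → Nonempty (col i j ∩ P)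
  col-meets i j P r< = n<∣p∣+∣q∣⇒p∩q≢∅ (col i j) P (subst (λ t → r < t + ∣ P ∣) (sym (∣col∣ i j)) r<)

  TcAtMost-∣P∣+∣Q∣ : (P Q : Subset r) → r < k + ∣ P ∣ → (∀ {c} → c ∈ P → c ∉ S → c ∈ Q) →
                     TcAtMost φ (∣ P ∣ + ∣ Q ∣)
  TcAtMost-∣P∣+∣Q∣ P Q r<k+∣P∣ P∖S⊆Q = covers⇒TcAtMost Ts (≤-reflexive length-Ts) cover
    where
    Ts : List (MonoTree φ)
    Ts = map x-ball (toList P) ++ map y-ball (toList Q)
    length-Ts : length Ts ≡ ∣ P ∣ + ∣ Q ∣
    length-Ts = trans (length-++ (map x-ball (toList P)))
                      (cong₂ _+_ (length-trees-over x-ball P) (length-trees-over y-ball Q))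
    cover : Covers Ts
    cover (inj₂ b) with col-meets zero b P r<k+∣P∣
    ... | c , c∈ with x∈p∩q⁻ _ P c∈
    ...   | c∈xb , c∈P = ++⁺ˡ (∈-trees-over c∈P (inj₂∈x-ball c∈xb))
    cover (inj₁ a) with col-meets a zero P r<k+∣P∣
    ... | c , c∈ with x∈p∩q⁻ _ P c∈ | c ∈? S
    ...   | c∈ay , c∈P | yes c∈S = ++⁺ˡ (∈-trees-over c∈P (inj₁∈x-ball c∈S c∈ay))
    ...   | c∈ay , c∈P | no  c∉S = ++⁺ʳ _ (∈-trees-over (P∖S⊆Q c∈P c∉S) (inj₁∈y-ball c∈ay))

  TcAtMost-r<2k : k ≤ r → r < 2 * k → TcAtMost φ (r ∸ k + 1)
  TcAtMost-r<2k k≤r r<2k with ∃-⊆-of-size S (r ∸ k + 1) (subst (r ∸ k + 1 ≤_) (sym (∣col∣ zero zero)) (r<2k⇒r∸k+1≤k k≤r r<2k))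
  ... | W , W⊆S , ∣W∣ = subst (TcAtMost φ) size (TcAtMost-∣P∣+∣Q∣ W ⊥ r<k+∣W∣ W∖S⊆⊥)
    where
    r<k+∣W∣ : r < k + ∣ W ∣
    r<k+∣W∣ = subst (λ t → r < k + t) (sym ∣W∣) (r<k+[r∸k+1] k≤r)
    W∖S⊆⊥ : ∀ {c} → c ∈ W → c ∉ S → c ∈ ⊥
    W∖S⊆⊥ c∈W c∉S = contradiction (W⊆S c∈W) c∉S
    size : ∣ W ∣ + ∣ ⊥ {r} ∣ ≡ r ∸ k + 1
    size = trans (cong₂ _+_ ∣W∣ (∣⊥∣≡0 r)) (+-identityʳ _)

  TcAtMost-2k<r : 1 ≤ k → 2 * k < r → TcAtMost φ (2 * r ∸ 3 * k + 2)
  TcAtMost-2k<r 1≤k 2k<r with 2k<r⇒sizes 1≤k 2k<r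
  ... | j , j≤r∸k , r<k+[k+j] , count with ∃-⊆-of-size (∁ S) j (subst (j ≤_) (sym ∣∁S∣) j≤r∸k)
  ...   | R , R⊆∁S , ∣R∣ = subst (TcAtMost φ) size (TcAtMost-∣P∣+∣Q∣ (S ∪ R) R r<k+∣S∪R∣ S∪R∖S⊆R)
    where
    S∩R≡∅ : Empty (S ∩ R)
    S∩R≡∅ (c , c∈S∩R) = let (c∈S , c∈R) = x∈p∩q⁻ S R c∈S∩R in x∈∁p⇒x∉p (R⊆∁S c∈R) c∈S
    ∣S∪R∣ : ∣ S ∪ R ∣ ≡ k + j
    ∣S∪R∣ = trans (∣p∪q∣≡∣p∣+∣q∣ S R S∩R≡∅) (cong₂ _+_ (∣col∣ zero zero) ∣R∣)
    r<k+∣S∪R∣ : r < k + ∣ S ∪ R ∣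
    r<k+∣S∪R∣ = subst (λ t → r < k + t) (sym ∣S∪R∣) r<k+[k+j]
    S∪R∖S⊆R : ∀ {c} → c ∈ S ∪ R → c ∉ S → c ∈ R
    S∪R∖S⊆R c∈S∪R c∉S with x∈p∪q⁻ S R c∈S∪R
    ... | inj₁ c∈S = contradiction c∈S c∉S
    ... | inj₂ c∈R = c∈R
    size : ∣ S ∪ R ∣ + ∣ R ∣ ≡ 2 * r ∸ 3 * k + 2
    size = trans (cong₂ _+_ ∣S∪R∣ ∣R∣) count

  module _ (1≤k : 1 ≤ k) (r≡2k : r ≡ 2 * k) where

    r∸k≡k : r ∸ k ≡ k
    r∸k≡k = trans (cong (_∸ k) r≡2k) (2*k∸k≡k k)

    disjoint-k-sets⇒∁p⊆q : (p q : Subset r) → ∣ p ∣ ≡ k → ∣ q ∣ ≡ k → Empty (p ∩ q) → ∁ p ⊆ q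
    disjoint-k-sets⇒∁p⊆q p q ∣p∣ ∣q∣ p∩q≡∅ = p∩q≡∅⇒∁p⊆q p q p∩q≡∅ (≤-reflexive (begin
      r              ≡⟨ r≡2k ⟩
      k + (k + 0)    ≡⟨ cong (k +_) (+-identityʳ k) ⟩
      k + k          ≡⟨ cong₂ _+_ ∣p∣ ∣q∣ ⟨
      ∣ p ∣ + ∣ q ∣  ∎))
      where open ≡-Reasoning

    S≢∅ : Nonempty S
    S≢∅ = 0<∣p∣⇒p≢∅ S (subst (1 ≤_) (sym (∣col∣ zero zero)) 1≤k)

    ∁S≢∅ : Nonempty (∁ S)
    ∁S≢∅ = 0<∣p∣⇒p≢∅ (∁ S) (subst (1 ≤_) (sym (trans ∣∁S∣ r∸k≡k)) 1≤k)

    BadA : Fin (suc n) → Set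
    BadA a = Empty (S ∩ col a zero)

    BadB : Fin (suc m) → Set
    BadB b = Empty (S ∩ col zero b)

    ∁S⊆bad-col-a : {a : Fin (suc n)} → BadA a → ∁ S ⊆ col a zero
    ∁S⊆bad-col-a {a} = disjoint-k-sets⇒∁p⊆q S (col a zero) (∣col∣ zero zero) (∣col∣ a zero)

    ∁S⊆bad-col-b : {b : Fin (suc m)} → BadB b → ∁ S ⊆ col zero b
    ∁S⊆bad-col-b {b} = disjoint-k-sets⇒∁p⊆q S (col zero b) (∣col∣ zero zero) (∣col∣ zero b)

    MixedBadEdge : Set
    MixedBadEdge = ∃[ a ] ∃[ b ] BadA a × BadB b × Nonempty (∁ S ∩ col a b)

    MixedBadEdge? : Dec MixedBadEdge
    MixedBadEdge? = Fin.any? λ a → Fin.any? λ b →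
      ¬? (nonempty? _) ×-dec ¬? (nonempty? _) ×-dec nonempty? (∁ S ∩ col a b)

    S⊆bad-col : ¬ MixedBadEdge → {a : Fin (suc n)} {b : Fin (suc m)} → BadA a → BadB b → S ⊆ col a b
    S⊆bad-col ¬mixed {a} {b} bad-a bad-b c∈S =
      disjoint-k-sets⇒∁p⊆q (∁ S) (col a b) (trans ∣∁S∣ r∸k≡k) (∣col∣ a b)
        (λ ne → ¬mixed (a , b , bad-a , bad-b , ne)) (x∉p⇒x∈∁p (x∈p⇒x∉∁p c∈S))

    CoversBad : MonoTree φ → Set
    CoversBad T = (∀ a → BadA a → inj₁ a ∈ₗ vertices T) × (∀ b → BadB b → inj₂ b ∈ₗ vertices T)

    bad-tree-via-mixed-edge : MixedBadEdge → Σ[ T ∈ MonoTree φ ] CoversBad T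
    bad-tree-via-mixed-edge (a₁ , b₁ , bad-a₁ , bad-b₁ , t , t∈) with x∈p∩q⁻ (∁ S) (col a₁ b₁) t∈
    ... | t∉S , t∈a₁b₁ =
      ball t x 4 ,
      (λ a bad-a → walk⇒∈ball x 4 (stay ▷⟨ ∁S⊆bad-col-b bad-b₁ t∉S ⟩ inj₂ b₁ ▷⟨ t∈a₁b₁ ⟩ inj₁ a₁
                                         ▷⟨ ∁S⊆bad-col-a bad-a₁ t∉S ⟩ y ▷⟨ ∁S⊆bad-col-a bad-a t∉S ⟩ inj₁ a)) ,
      (λ b bad-b → walk⇒∈ball x 4 (stay ▷⟨ ∁S⊆bad-col-b bad-b t∉S ⟩ inj₂ b))

    bad-tree-without-bad-a : (∀ a → ¬ BadA a) → Σ[ T ∈ MonoTree φ ] CoversBad T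
    bad-tree-without-bad-a no-bad-a with ∁S≢∅
    ... | t , t∉S =
      ball t x 1 ,
      (λ a bad-a → contradiction bad-a (no-bad-a a)) ,
      (λ b bad-b → walk⇒∈ball x 1 (stay ▷⟨ ∁S⊆bad-col-b bad-b t∉S ⟩ inj₂ b))

    bad-tree-without-bad-b : (∀ b → ¬ BadB b) → Σ[ T ∈ MonoTree φ ] CoversBad T
    bad-tree-without-bad-b no-bad-b with ∁S≢∅
    ... | t , t∉S =
      ball t y 1 ,
      (λ a bad-a → walk⇒∈ball y 1 (stay ▷⟨ ∁S⊆bad-col-a bad-a t∉S ⟩ inj₁ a)) ,
      (λ b bad-b → contradiction bad-b (no-bad-b b))

    bad-tree-at-bad-a : ¬ MixedBadEdge → ∀ {a₀ b₀} → BadA a₀ → BadB b₀ → Σ[ T ∈ MonoTree φ ] CoversBad T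
    bad-tree-at-bad-a ¬mixed {a₀} {b₀} bad-a₀ bad-b₀ with S≢∅
    ... | s , s∈S =
      ball s (inj₁ a₀) 2 ,
      (λ a bad-a → walk⇒∈ball (inj₁ a₀) 2 (stay ▷⟨ s∈ bad-a₀ bad-b₀ ⟩ inj₂ b₀ ▷⟨ s∈ bad-a bad-b₀ ⟩ inj₁ a)) ,
      (λ b bad-b → walk⇒∈ball (inj₁ a₀) 2 (stay ▷⟨ s∈ bad-a₀ bad-b ⟩ inj₂ b))
      where
      s∈ : ∀ {a b} → BadA a → BadB b → s ∈ col a b
      s∈ bad-a bad-b = S⊆bad-col ¬mixed bad-a bad-b s∈S

    bad-tree : Σ[ T ∈ MonoTree φ ] CoversBad T
    bad-tree with MixedBadEdge? | Fin.any? (λ a → ¬? (nonempty? (S ∩ col a zero)))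
                                | Fin.any? (λ b → ¬? (nonempty? (S ∩ col zero b)))
    ... | yes mixed  | _                 | _                 = bad-tree-via-mixed-edge mixed
    ... | no  _      | no ∄bad-a         | _                 = bad-tree-without-bad-a λ a bad-a → ∄bad-a (a , bad-a)
    ... | no  _      | _                 | no ∄bad-b         = bad-tree-without-bad-b λ b bad-b → ∄bad-b (b , bad-b)
    ... | no ¬mixed  | yes (_ , bad-a₀)  | yes (_ , bad-b₀)  = bad-tree-at-bad-a ¬mixed bad-a₀ bad-b₀

    TcAtMost-r≡2k : TcAtMost φ (r ∸ k + 1)
    TcAtMost-r≡2k = covers⇒TcAtMost Ts (≤-reflexive length-Ts) cover
      where
      Ts : List (MonoTree φ)
      Ts = map x-ball (toList S) ++ [ proj₁ bad-tree ]
      length-Ts : length Ts ≡ r ∸ k + 1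
      length-Ts = begin
        length Ts                           ≡⟨ length-++ (map x-ball (toList S)) ⟩
        length (map x-ball (toList S)) + 1  ≡⟨ cong (_+ 1) (length-trees-over x-ball S) ⟩
        ∣ S ∣ + 1                           ≡⟨ cong (_+ 1) (trans (∣col∣ zero zero) (sym r∸k≡k)) ⟩
        r ∸ k + 1                           ∎
        where open ≡-Reasoning
      cover : Covers Ts
      cover (inj₁ a) with nonempty? (S ∩ col a zero)
      ... | yes (c , c∈) = let (c∈S , c∈ay) = x∈p∩q⁻ S _ c∈ in ++⁺ˡ (∈-trees-over c∈S (inj₁∈x-ball c∈S c∈ay))
      ... | no bad-a     = ++⁺ʳ _ (Any.here (proj₁ (proj₂ bad-tree) a bad-a))
      cover (inj₂ b) with nonempty? (S ∩ col zero b)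
      ... | yes (c , c∈) = let (c∈S , c∈xb) = x∈p∩q⁻ S _ c∈ in ++⁺ˡ (∈-trees-over c∈S (inj₂∈x-ball c∈xb))
      ... | no bad-b     = ++⁺ʳ _ (Any.here (proj₂ (proj₂ bad-tree) b bad-b))

lemma3p1 : (r k : ℕ) → 1 ≤ k → k ≤ r → (n m : ℕ) → 1 ≤ n → 1 ≤ m →
           TcRK-AtMost r k n m (bound r k)
lemma3p1 r k 1≤k k≤r (suc n) (suc m) _ _ φ with r ≤? 2 * k
... | no  r≰2k = Covering.TcAtMost-2k<r φ 1≤k (≰⇒> r≰2k)
... | yes r≤2k with m≤n⇒m<n∨m≡n r≤2k
...   | inj₁ r<2k = Covering.TcAtMost-r<2k φ k≤r r<2k
...   | inj₂ r≡2k = Covering.TcAtMost-r≡2k φ 1≤k r≡2k
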